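{- For integers $1\le a\le b$, there exists a graph $G$ with $\chi_\mu(G)=a$ and $\chi_{\mathrm{gp}}(G)=b$ if and only if $a=b=1$ or $2\le a\le b$.
   Context: A set $S$ is in general position if no shortest path of the graph contains more than two vertices of $S$; $S$ is a mutual-visibility set if for any $u,v\in S$ there is a shortest $u,v$-path containing no vertex of $S\setminus\{u,v\}$. $\chi_{\mathrm{gp}}(G)$ (resp. $\chi_\mu(G)$) is the minimum number of colours in a colouring of $V(G)$ in which each colour class is in general position (resp. is a mutual-visibility set). -}

module Defs where

open import Data.Nat using (ℕ; _≤_)
open import Data.Fin using (Fin; _≟_)
open import Data.Bool using (Bool; true; false)
open import Data.List using (List; []; _∷_; [_]; length; filter)
open import Data.List.Relation.Unary.All using (All)
open import Data.Product using (Σ; ∃; ∃-syntax; _×_)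
open import Data.Sum using (_⊎_)
open import Relation.Binary.PropositionalEquality using (_≡_; _≢_)
open import Relation.Nullary.Decidable using (⌊_⌋)
open import Data.Bool using (T)
open import Data.Bool.Properties using (T?)

record Graph (n : ℕ) : Set where
  field
    adj    : Fin n → Fin n → Bool
    sym    : ∀ u v → adj u v ≡ adj v u
    irrefl : ∀ u → adj u u ≡ false
open Graph public

-- Walk G u v p : the vertex list p (starting with u, ending with v) is a walk
-- from u to v in G.  The number of edges is (length p) - 1.
data Walk {n : ℕ} (G : Graph n) : Fin n → Fin n → List (Fin n) → Set where
  here : ∀ {u} → Walk G u u [ u ]
  step : ∀ {u w v p} → adj G u w ≡ true → Walk G w v p → Walk G u v (u ∷ p)

ShortestPath : {n : ℕ} → Graph n → Fin n → Fin n → List (Fin n) → Set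
ShortestPath G u v p =
  Walk G u v p × (∀ q → Walk G u v q → length p ≤ length q)

Connected : {n : ℕ} → Graph n → Set
Connected {n} G = ∀ (u v : Fin n) → ∃[ p ] Walk G u v p

GeneralPosition : {n : ℕ} → Graph n → (Fin n → Bool) → Set
GeneralPosition G S =
  ∀ u v p → ShortestPath G u v p → length (filter (λ w → T? (S w)) p) ≤ 2

MutualVisibility : {n : ℕ} → Graph n → (Fin n → Bool) → Set
MutualVisibility G S =
  ∀ u v → S u ≡ true → S v ≡ true →
    ∃[ p ] (ShortestPath G u v p × All (λ w → S w ≡ true → w ≡ u ⊎ w ≡ v) p)

ColourClass : {n k : ℕ} → (Fin n → Fin k) → Fin k → Fin n → Bool
ColourClass c i w = ⌊ c w ≟ i ⌋

PColouring : {n : ℕ} → ((Fin n → Bool) → Set) → ℕ → Set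
PColouring {n} P k = Σ (Fin n → Fin k) λ c → ∀ (i : Fin k) → P (ColourClass c i)

IsMinColours : {n : ℕ} → ((Fin n → Bool) → Set) → ℕ → Set
IsMinColours P a = PColouring P a × (∀ k → PColouring P k → a ≤ k)

IsChiGp : {n : ℕ} → Graph n → ℕ → Set
IsChiGp G b = IsMinColours (GeneralPosition G) b

IsChiMu : {n : ℕ} → Graph n → ℕ → Set
IsChiMu G a = IsMinColours (MutualVisibility G) a

-- For 2 ≤ a ≤ b take 2b layers of vertices, adjacent exactly when their layers are consecutive, where
-- 2(b - a) consecutive middle layers hold two vertices and the other 2a layers one.  Geodesics between
-- different layers climb one layer per step.  Hence colouring by layer modulo b puts each class into two
-- layers at distance b ≥ 2, which is in general position, while three equally coloured vertices of a spine
-- (one vertex per layer) lie on a common geodesic; pigeonhole over the 2b layers gives χ_gp = b.  A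
-- single-vertex layer is a cut, so the 2a single-vertex layers force a colours for mutual visibility, and a
-- colours suffice: colour the two blocks of single-vertex layers in parallel and the doubled layers by 0 and
-- 1, so that every geodesic can route through vertices of other colours.  When χ_μ = 1 the whole vertex set
-- is mutually visible, so no geodesic has three vertices and χ_gp = 1.

module Submission where

open import Defs hiding (sym)
open import Data.Bool using (Bool; true; false; _∨_)
open import Data.Bool.Properties using (T?; T-≡; ∨-comm; ¬-not)
open import Data.Empty using (⊥)
open import Data.Fin as Fin using (Fin; combine; toℕ; fromℕ<; splitAt; _↑ˡ_; _↑ʳ_)
  renaming (zero to fzero; suc to fsuc)
open import Data.Fin.Properties
  using (pigeonhole; any?; combine-injective; toℕ-fromℕ<; toℕ-injective; toℕ<n; toℕ-↑ˡ; toℕ-↑ʳ;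
         splitAt-↑ˡ; splitAt-↑ʳ; splitAt⁻¹-↑ˡ; splitAt⁻¹-↑ʳ)
open import Data.List using (List; []; _∷_; [_]; length; filter; reverse; _∷ʳ_)
open import Data.List.Properties using (length-filter; unfold-reverse; length-reverse)
open import Data.List.Membership.Propositional using (_∈_)
open import Data.List.Membership.Propositional.Properties using (∈-filter⁺)
open import Data.List.Relation.Binary.Permutation.Propositional using (↭-sym)
open import Data.List.Relation.Binary.Permutation.Propositional.Properties
  using (↭-reverse; ↭-length; filter-↭; All-resp-↭)
open import Data.List.Relation.Unary.All as All using (All; []; _∷_)
open import Data.List.Relation.Unary.All.Properties using (all-filter)
open import Data.List.Relation.Unary.Any using (Any; here; there; tail)
open import Data.List.Relation.Unary.Linked using (Linked; [-]; _∷_)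
import Data.List.Relation.Unary.Linked.Properties as Linked
open import Data.Nat using (ℕ; zero; suc; _+_; _*_; _∸_; _≤_; _<_; z≤n; s≤s; z<s; NonZero)
open import Data.Nat.DivMod using (_%_; m%n<n; m<n⇒m%n≡m; [m+n]%n≡m%n)
open import Data.Nat.Properties
open import Data.Nat.Tactic.RingSolver using (solve-∀)
open import Data.Product using (Σ; ∃-syntax; _×_; _,_; proj₁; proj₂)
open import Data.Sum using (_⊎_; inj₁; inj₂; swap; [_,_]′)
open import Data.Unit using (⊤; tt)
open import Function using (_∘_; id; case_of_; _on_)
open import Function.Bundles using (_⇔_; mk⇔; Equivalence)
open import Relation.Binary.Definitions using (tri<; tri≈; tri>)
open import Relation.Binary.PropositionalEquality hiding ([_])
open import Relation.Nullary using (¬_; Dec; yes; no)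
open import Relation.Nullary.Decidable using (_×-dec_; ⌊_⌋; toWitness; fromWitness; isYes≗does; dec-false)
open import Relation.Nullary.Negation using (contradiction)

private variable
  A : Set
  P Q R : A → Set
  n k : ℕ
  H : Graph n
  u v w x : Fin n
  p : List (Fin n)

count : (A → Bool) → List A → ℕ
count S p = length (filter (T? ∘ S) p)

count≤length : (S : A → Bool) (xs : List A) → count S xs ≤ length xs
count≤length S = length-filter (T? ∘ S)

count-accept : (S : A → Bool) {x : A} (xs : List A) →
               S x ≡ true → count S (x ∷ xs) ≡ suc (count S xs)
count-accept S xs Sx rewrite Sx = refl

count-reject : (S : A → Bool) {x : A} (xs : List A) →
               S x ≡ false → count S (x ∷ xs) ≡ count S xs
count-reject S xs Sx rewrite Sx = refl

count-reverse : (S : A → Bool) (xs : List A) → count S (reverse xs) ≡ count S xs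
count-reverse S xs = ↭-length (filter-↭ (T? ∘ S) (↭-reverse xs))

count-triple : (S : A → Bool) (x y z : A) → (S x ≡ true → S y ≡ false) →
               count S (x ∷ y ∷ z ∷ []) ≤ 2
count-triple S x y z indep = by-cases (S x) refl
  where
  open ≤-Reasoning
  by-cases : (b : Bool) → S x ≡ b → count S (x ∷ y ∷ z ∷ []) ≤ 2
  by-cases true Sx = begin
    count S (x ∷ y ∷ z ∷ [])    ≡⟨ count-accept S _ Sx ⟩
    suc (count S (y ∷ z ∷ []))  ≡⟨ cong suc (count-reject S _ (indep Sx)) ⟩
    suc (count S (z ∷ []))      ≤⟨ s≤s (count≤length S (z ∷ [])) ⟩
    2                           ∎
  by-cases false Sx = begin
    count S (x ∷ y ∷ z ∷ [])  ≡⟨ count-reject S _ Sx ⟩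
    count S (y ∷ z ∷ [])      ≤⟨ count≤length S (y ∷ z ∷ []) ⟩
    2                         ∎

member⇒nonempty : {x : A} {xs : List A} → x ∈ xs → 1 ≤ length xs
member⇒nonempty (here _)  = s≤s z≤n
member⇒nonempty (there _) = s≤s z≤n

two-members⇒length≥2 : {x y : A} {xs : List A} → x ∈ xs → y ∈ xs → x ≢ y → 2 ≤ length xs
two-members⇒length≥2 (here refl) y∈ x≢y = s≤s (member⇒nonempty (tail (x≢y ∘ sym) y∈))
two-members⇒length≥2 (there x∈) (here refl) x≢y = s≤s (member⇒nonempty x∈)
two-members⇒length≥2 (there x∈) (there y∈) x≢y = m≤n⇒m≤1+n (two-members⇒length≥2 x∈ y∈ x≢y)

three-members⇒length≥3 : {x y z : A} {xs : List A} → x ∈ xs → y ∈ xs → z ∈ xs →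
                         x ≢ y → x ≢ z → y ≢ z → 3 ≤ length xs
three-members⇒length≥3 (here refl) y∈ z∈ x≢y x≢z y≢z =
  s≤s (two-members⇒length≥2 (tail (x≢y ∘ sym) y∈) (tail (x≢z ∘ sym) z∈) y≢z)
three-members⇒length≥3 (there x∈) (here refl) z∈ x≢y x≢z y≢z =
  s≤s (two-members⇒length≥2 x∈ (tail (y≢z ∘ sym) z∈) x≢z)
three-members⇒length≥3 (there x∈) (there y∈) (here refl) x≢y x≢z y≢z =
  s≤s (two-members⇒length≥2 x∈ y∈ x≢y)
three-members⇒length≥3 (there x∈) (there y∈) (there z∈) x≢y x≢z y≢z =
  m≤n⇒m≤1+n (three-members⇒length≥3 x∈ y∈ z∈ x≢y x≢z y≢z)

walk-nonempty : Walk H u v p → 1 ≤ length p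
walk-nonempty here       = s≤s z≤n
walk-nonempty (step _ _) = s≤s z≤n

walk-∷ʳ : Walk H u w p → adj H w v ≡ true → Walk H u v (p ∷ʳ v)
walk-∷ʳ here         e = step e here
walk-∷ʳ (step e′ wk) e = step e′ (walk-∷ʳ wk e)

walk-reverse : Walk H u v p → Walk H v u (reverse p)
walk-reverse here = here
walk-reverse {H = H} (step {u = u} {w} {p = p} e wk) =
  subst (Walk H _ u) (sym (unfold-reverse u p))
        (walk-∷ʳ (walk-reverse wk) (trans (Graph.sym H w u) e))

shortestPath-reverse : ShortestPath H u v p → ShortestPath H v u (reverse p)
shortestPath-reverse {p = p} (wk , shortest) =
  walk-reverse wk ,
  λ q wq → subst₂ _≤_ (sym (length-reverse p)) (length-reverse q)
                  (shortest (reverse q) (walk-reverse wq))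

all-any-combine : {xs : List A} → All P xs → Any Q xs → (∀ {x} → P x → Q x → R x) → Any R xs
all-any-combine (px ∷ _)   (here qx) f = here (f px qx)
all-any-combine (_ ∷ pxs) (there i)  f = there (all-any-combine pxs i f)

endpointsOnly-shortestPath-length : ShortestPath H u v p → All (λ w → w ≡ u ⊎ w ≡ v) p → length p ≤ 2
endpointsOnly-shortestPath-length (here , _)      _ = s≤s z≤n
endpointsOnly-shortestPath-length (step e here , _) _ = s≤s (s≤s z≤n)
endpointsOnly-shortestPath-length {H = H} (step e (step _ _) , _) (_ ∷ inj₁ refl ∷ _)
  with trans (sym e) (Graph.irrefl H _)
... | ()
endpointsOnly-shortestPath-length (step e (step _ _) , shortest) (_ ∷ inj₂ refl ∷ _) = shortest _ (step e here)

visibleEverywhere⇒generalPosition : (S : Fin n → Bool) → MutualVisibility H S → (∀ w → S w ≡ true) →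
                                    (S′ : Fin n → Bool) → GeneralPosition H S′
visibleEverywhere⇒generalPosition S visible all S′ u v q (wq , shortestq)
  with visible u v (all u) (all v)
... | p , sp@(wp , _) , vis = begin
  count S′ q  ≤⟨ count≤length S′ q ⟩
  length q    ≤⟨ shortestq p wp ⟩
  length p    ≤⟨ endpointsOnly-shortestPath-length sp (All.map (λ {w} inS⇒end → inS⇒end (all w)) vis) ⟩
  2           ∎
  where open ≤-Reasoning

colourClass⇒ : (c : Fin n → Fin k) (w : Fin n) {i : Fin k} → ColourClass c i w ≡ true → c w ≡ i
colourClass⇒ c w e = toWitness (Equivalence.from T-≡ e)

⇒colourClass : (c : Fin n → Fin k) (w : Fin n) {i : Fin k} → c w ≡ i → ColourClass c i w ≡ true
⇒colourClass c w e = Equivalence.to T-≡ (fromWitness e)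

module _ {N : ℕ} (f : Fin N → Fin k) where

  private
    HasEarlierTwin : Fin N → Set
    HasEarlierTwin y = ∃[ x ] x Fin.< y × f x ≡ f y

    hasEarlierTwin? : ∀ y → Dec (HasEarlierTwin y)
    hasEarlierTwin? y = any? (λ x → (x Fin.<? y) ×-dec (f x Fin.≟ f y))

    indicator : {B : Set} → Dec B → Fin 2
    indicator (yes _) = fsuc fzero
    indicator (no _)  = fzero

    double : k * 2 ≡ k + k
    double = trans (*-comm k 2) (cong (k +_) (+-identityʳ k))

  -- Pigeonhole on the 2k pairs (colour of y, whether some x < y has the colour of y).
  monochromaticTriple : k + k < N →
    ∃[ x ] ∃[ y ] ∃[ z ] x Fin.< y × y Fin.< z × f x ≡ f y × f y ≡ f z
  monochromaticTriple k+k<N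
    with x , y , x<y , same ← pigeonhole (subst (_< N) (sym double) k+k<N)
                                        (λ y → combine (f y) (indicator (hasEarlierTwin? y)))
    with fx≡fy , sameIndicator ← combine-injective (f x) _ (f y) _ same
    = extend (hasEarlierTwin? x) (hasEarlierTwin? y) sameIndicator
    where
    extend : (dx : Dec (HasEarlierTwin x)) (dy : Dec (HasEarlierTwin y)) → indicator dx ≡ indicator dy →
             ∃[ x ] ∃[ y ] ∃[ z ] x Fin.< y × y Fin.< z × f x ≡ f y × f y ≡ f z
    extend (yes (w , w<x , fw≡fx)) _ _ = w , x , y , w<x , x<y , fw≡fx , fx≡fy
    extend (no _) (no ¬twin) _ = contradiction (x , x<y , fx≡fy) ¬twin

data SplitAtView (m : ℕ) {k : ℕ} : Fin (m + k) → Set where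
  left  : (i : Fin m) → SplitAtView m (i ↑ˡ k)
  right : (j : Fin k) → SplitAtView m (m ↑ʳ j)

splitAtView : ∀ m {k} (i : Fin (m + k)) → SplitAtView m i
splitAtView m i with splitAt m i in eq
... | inj₁ j = subst (SplitAtView m) (splitAt⁻¹-↑ˡ eq) (left j)
... | inj₂ j = subst (SplitAtView m) (splitAt⁻¹-↑ʳ eq) (right j)

%-values : ∀ {ℓ} m .{{_ : NonZero m}} → ℓ < m + m → ℓ ≡ ℓ % m ⊎ ℓ ≡ ℓ % m + m
%-values {ℓ} m ℓ<2m with ℓ <? m
... | yes ℓ<m = inj₁ (sym (m<n⇒m%n≡m ℓ<m))
... | no ℓ≮m  = inj₂ (begin
  ℓ                      ≡⟨ m∸n+n≡m m≤ℓ ⟨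
  ℓ ∸ m + m              ≡⟨ cong (_+ m) (m<n⇒m%n≡m ℓ∸m<m) ⟨
  (ℓ ∸ m) % m + m        ≡⟨ cong (_+ m) ([m+n]%n≡m%n (ℓ ∸ m) m) ⟨
  (ℓ ∸ m + m) % m + m    ≡⟨ cong (λ x → x % m + m) (m∸n+n≡m m≤ℓ) ⟩
  ℓ % m + m              ∎)
  where
  open ≡-Reasoning
  m≤ℓ : m ≤ ℓ
  m≤ℓ = ≮⇒≥ ℓ≮m
  ℓ∸m<m : ℓ ∸ m < m
  ℓ∸m<m = subst (ℓ ∸ m <_) (m+n∸n≡m m m) (∸-monoˡ-< ℓ<2m m≤ℓ)

double-cancel-≤ : ∀ {m n} → m + m ≤ n + n → m ≤ n
double-cancel-≤ m+m≤n+n = ≮⇒≥ λ n<m → <⇒≱ (+-mono-< n<m n<m) m+m≤n+n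

span-length : ∀ {i j k} → suc i + k ≡ j → i + (2 + k) ≡ suc j
span-length {i} {j} {k} e = trans (+-suc i (suc k)) (cong suc (trans (+-suc i k) e))

module Layered {n : ℕ} (lay : Fin n → ℕ) where

  Consecutive : ℕ → ℕ → Set
  Consecutive x y = suc x ≡ y ⊎ suc y ≡ x

  adjacent : ℕ → ℕ → Bool
  adjacent x y = ⌊ suc x ≟ y ⌋ ∨ ⌊ suc y ≟ x ⌋

  adjacent-irrefl : ∀ x → adjacent x x ≡ false
  adjacent-irrefl x = cong₂ _∨_ never never
    where
    never : ⌊ suc x ≟ x ⌋ ≡ false
    never = trans (isYes≗does (suc x ≟ x)) (dec-false (suc x ≟ x) (1+n≢n))

  adjacent⇒consecutive : ∀ x y → adjacent x y ≡ true → Consecutive x y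
  adjacent⇒consecutive x y e with suc x ≟ y | suc y ≟ x
  ... | yes up | _      = inj₁ up
  ... | no _   | yes dn = inj₂ dn
  ... | no _   | no _   with () ← e

  consecutive⇒adjacent : ∀ x y → Consecutive x y → adjacent x y ≡ true
  consecutive⇒adjacent x y c with suc x ≟ y | suc y ≟ x | c
  ... | yes _ | _     | _      = refl
  ... | no _  | yes _ | _      = refl
  ... | no ¬up | no _  | inj₁ up = contradiction up ¬up
  ... | no _  | no ¬dn | inj₂ dn = contradiction dn ¬dn

  G : Graph n
  G = record
    { adj    = λ u v → adjacent (lay u) (lay v)
    ; sym    = λ u v → ∨-comm ⌊ suc (lay u) ≟ lay v ⌋ ⌊ suc (lay v) ≟ lay u ⌋
    ; irrefl = λ u → adjacent-irrefl (lay u)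
    }

  step-consecutive : adj G u w ≡ true → Consecutive (lay u) (lay w)
  step-consecutive {u} {w} = adjacent⇒consecutive (lay u) (lay w)

  consecutive-step : Consecutive (lay u) (lay w) → adj G u w ≡ true
  consecutive-step {u} {w} = consecutive⇒adjacent (lay u) (lay w)

  consecutive-≤ : ∀ {x y} → Consecutive x y → y ≤ suc x
  consecutive-≤ (inj₁ refl) = ≤-refl
  consecutive-≤ (inj₂ refl) = m≤n+m _ 2

  consecutive-irrefl : ∀ {x} → Consecutive x x → ⊥
  consecutive-irrefl (inj₁ e) = 1+n≢n e
  consecutive-irrefl (inj₂ e) = 1+n≢n e

  walk-climb : Walk G u v p → lay v < lay u + length p
  walk-climb {u} here = m<m+n (lay u) z<s
  walk-climb {u} {v} (step {w = w} {p = p} e wk) = begin-strict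
    lay v                  <⟨ walk-climb wk ⟩
    lay w + length p       ≤⟨ +-monoˡ-≤ (length p) (consecutive-≤ (step-consecutive e)) ⟩
    suc (lay u) + length p ≡⟨ +-suc (lay u) (length p) ⟨
    lay u + suc (length p) ∎
    where open ≤-Reasoning

  _≺_ : Fin n → Fin n → Set
  _≺_ = _<_ on lay

  tight-ascending : Walk G u v p → lay u + length p ≡ suc (lay v) → Linked _≺_ p
  tight-ascending here _ = [-]
  tight-ascending {u} {v} (step {w = w} {p = p} e wk) tight with step-consecutive e
  ... | inj₁ up = ascend up wk (tight-ascending wk (begin
    lay w + length p       ≡⟨ cong (_+ length p) up ⟨
    suc (lay u) + length p ≡⟨ +-suc (lay u) (length p) ⟨
    lay u + suc (length p) ≡⟨ tight ⟩
    suc (lay v)            ∎))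
    where
    open ≡-Reasoning
    ascend : suc (lay u) ≡ lay w → Walk G w v p → Linked _≺_ p → Linked _≺_ (u ∷ p)
    ascend up here       _  = ≤-reflexive up ∷ [-]
    ascend up (step _ _) ps = ≤-reflexive up ∷ ps
  ... | inj₂ down = contradiction (walk-climb wk) (≤⇒≯ (begin
    lay w + length p             <⟨ n<1+n _ ⟩
    suc (lay w + length p)       ≡⟨ +-suc (lay w) (length p) ⟨
    lay w + suc (length p)       ≤⟨ ≤-pred (≤-reflexive (trans (cong (_+ suc (length p)) down) tight)) ⟩
    lay v                        ∎))
    where open ≤-Reasoning

  Populated : (Fin n → Set) → ℕ → ℕ → Set
  Populated P i j = ∀ ℓ → i < ℓ → ℓ < j → ∃[ w ] lay w ≡ ℓ × P w

  ascent : (P : Fin n → Set) (k : ℕ) → suc (lay u) + k ≡ lay v → P u → P v →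
           Populated P (lay u) (lay v) → ∃[ p ] Walk G u v p × length p ≡ 2 + k × All P p
  ascent P zero e Pu Pv _ =
    _ , step (consecutive-step (inj₁ (trans (sym (+-identityʳ _)) e))) here , refl , Pu ∷ Pv ∷ []
  ascent {u} {v} P (suc k) e Pu Pv populated =
    let w , lw , Pw = populated (suc (lay u)) ≤-refl (subst (suc (lay u) <_) e (m<m+n _ z<s))
        p , wk , len , all = ascent P k (trans (cong (λ m → suc m + k) lw) rest) Pw Pv
                                        (λ ℓ w<ℓ → populated ℓ (<-trans (n<1+n _) (subst (_< ℓ) lw w<ℓ)))
    in u ∷ p , step (consecutive-step (inj₁ (sym lw))) wk , cong suc len , Pu ∷ all
    where
    rest : suc (suc (lay u)) + k ≡ lay v
    rest = trans (sym (+-suc (suc (lay u)) k)) e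

  ascent-shortest : Walk G u v p → length p ≡ 2 + k → suc (lay u) + k ≡ lay v → ShortestPath G u v p
  ascent-shortest {u} {v} {p} {k} wk len e = wk , λ q wq → begin
    length p ≡⟨ len ⟩
    2 + k    ≤⟨ +-cancelˡ-≤ (lay u) _ _ (begin
                  lay u + (2 + k)       ≡⟨ span-length e ⟩
                  suc (lay v)           ≤⟨ walk-climb wq ⟩
                  lay u + length q      ∎) ⟩
    length q ∎
    where open ≤-Reasoning

  ascendingPath : (P : Fin n → Set) → lay u < lay v → P u → P v → Populated P (lay u) (lay v) →
                  ∃[ p ] ShortestPath G u v p × All P p
  ascendingPath P u<v Pu Pv populated
    with k , e ← m≤n⇒∃[o]m+o≡n u<v
    with p , wk , len , all ← ascent P k e Pu Pv populated
    = p , ascent-shortest wk len e , all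

  populated-map : ∀ {i j} → (∀ {w} → P w → Q w) → Populated P i j → Populated Q i j
  populated-map f populatedP ℓ i<ℓ ℓ<j = let w , lw , Pw = populatedP ℓ i<ℓ ℓ<j in w , lw , f Pw

  unobstructedPath : (S : Fin n → Bool) → lay u < lay v → Populated (λ w → S w ≡ false) (lay u) (lay v) →
                     ∃[ p ] ShortestPath G u v p × All (λ w → S w ≡ true → w ≡ u ⊎ w ≡ v) p
  unobstructedPath S u<v gaps = ascendingPath _ u<v (λ _ → inj₁ refl) (λ _ → inj₂ refl)
    (populated-map (λ Sw≡false Sw≡true → contradiction (trans (sym Sw≡false) Sw≡true) λ ()) gaps)

  walk-crosses : ∀ {ℓ} → Walk G u v p → lay u ≤ ℓ → ℓ ≤ lay v → Any (λ w → lay w ≡ ℓ) p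
  walk-crosses here u≤ℓ ℓ≤v = here (≤-antisym u≤ℓ ℓ≤v)
  walk-crosses {u} {ℓ = ℓ} (step e wk) u≤ℓ ℓ≤v with lay u ≟ ℓ
  ... | yes u≡ℓ = here u≡ℓ
  ... | no u≢ℓ  = there (walk-crosses wk (≤-trans (consecutive-≤ (step-consecutive e)) (≤∧≢⇒< u≤ℓ u≢ℓ)) ℓ≤v)

  cutVertex-blocks : (S : Fin n → Bool) → MutualVisibility G S → lay u < lay x → lay x < lay v →
                     (∀ w → lay w ≡ lay x → w ≡ x) → S u ≡ true → S x ≡ true → S v ≡ true → ⊥
  cutVertex-blocks {u} {x} {v} S visible u<x x<v isolated Su Sx Sv
    with p , (wk , _) , vis ← visible u v Su Sv
    = blocked (All.lookupAny vis (walk-crosses wk (<⇒≤ u<x) (<⇒≤ x<v)))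
    where
    blocked : ∀ {w} → (S w ≡ true → w ≡ u ⊎ w ≡ v) × lay w ≡ lay x → ⊥
    blocked (endpoint , lw) with refl ← isolated _ lw with endpoint Sx
    ... | inj₁ refl = <-irrefl refl u<x
    ... | inj₂ refl = <-irrefl refl x<v

  mutualVisibility-colours-lower : {N : ℕ} (θ : Fin N → Fin n) →
    (∀ {x y} → x Fin.< y → lay (θ x) < lay (θ y)) → (∀ x w → lay w ≡ lay (θ x) → w ≡ θ x) →
    PColouring (MutualVisibility G) k → N ≤ k + k
  mutualVisibility-colours-lower θ increasing isolated (c , visible) = ≮⇒≥ λ k+k<N →
    let x , y , z , x<y , y<z , cx≡cy , cy≡cz = monochromaticTriple (c ∘ θ) k+k<N
    in cutVertex-blocks (ColourClass c (c (θ y))) (visible (c (θ y))) (increasing x<y) (increasing y<z)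
         (isolated y) (⇒colourClass c _ cx≡cy) (⇒colourClass c _ refl) (⇒colourClass c _ (sym cy≡cz))

module LayeredWithSpine {n : ℕ} (lay : Fin n → ℕ) {L : ℕ} (spine : Fin L → Fin n)
              (lay-spine : ∀ ℓ → lay (spine ℓ) ≡ toℕ ℓ) (lay<L : ∀ w → lay w < L) (2≤L : 2 ≤ L) where

  open Layered lay

  vertexAt : ∀ {ℓ} → ℓ < L → ∃[ w ] lay w ≡ ℓ
  vertexAt ℓ<L = spine (fromℕ< ℓ<L) , trans (lay-spine _) (toℕ-fromℕ< ℓ<L)

  OnSpine : Fin n → Set
  OnSpine w = ∃[ ℓ ] w ≡ spine ℓ

  spine-populated : ∀ i → Populated OnSpine i (lay v)
  spine-populated {v} _ ℓ _ ℓ<v =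
    let w , lw = vertexAt (<-trans ℓ<v (lay<L v)) in w , lw , _ , refl

  populated : ∀ i → Populated (λ _ → ⊤) i (lay v)
  populated i ℓ i<ℓ ℓ<v = let w , lw , _ = spine-populated i ℓ i<ℓ ℓ<v in w , lw , tt

  neighbour : ∀ u → ∃[ w ] adj G u w ≡ true
  neighbour u with lay u | lay<L u
  ... | zero  | _    = let w , lw = vertexAt 2≤L in
                       w , consecutive⇒adjacent 0 (lay w) (inj₁ (sym lw))
  ... | suc ℓ | ℓ<L = let w , lw = vertexAt (<-trans (n<1+n ℓ) ℓ<L) in
                       w , consecutive⇒adjacent (suc ℓ) (lay w) (inj₂ (cong suc lw))

  sameLayer-walk : lay u ≡ lay v → ∃[ p ] Walk G u v p × length p ≡ 3
  sameLayer-walk {u} {v} same with w , e ← neighbour u =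
    _ , step e (step (subst (λ m → adjacent (lay w) m ≡ true) same (trans (Graph.sym G w u) e)) here) , refl

  connected : Connected G
  connected u v with <-cmp (lay u) (lay v)
  ... | tri< u<v _ _ = let p , (wk , _) , _ = ascendingPath (λ _ → ⊤) u<v tt tt (populated _) in p , wk
  ... | tri≈ _ same _ = let p , wk , _ = sameLayer-walk same in p , wk
  ... | tri> _ _ v<u = let p , (wk , _) , _ = ascendingPath (λ _ → ⊤) v<u tt tt (populated _) in
                        reverse p , walk-reverse wk

  shortest-ascending : ShortestPath G u v p → lay u < lay v → Linked _≺_ p
  shortest-ascending {u} {v} {p} (wk , shortest) u<v
    with k , e ← m≤n⇒∃[o]m+o≡n u<v
    with q , wq , len , _ ← ascent (λ _ → ⊤) k e tt tt (populated _)
    = tight-ascending wk (≤-antisym (begin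
        lay u + length p ≤⟨ +-monoʳ-≤ (lay u) (shortest q wq) ⟩
        lay u + length q ≡⟨ cong (lay u +_) len ⟩
        lay u + (2 + k)  ≡⟨ span-length e ⟩
        suc (lay v)      ∎) (walk-climb wk))
    where open ≤-Reasoning

  twoLayers-generalPosition : (S : Fin n → Bool) (i j : ℕ) → suc i < j →
                              (∀ w → S w ≡ true → lay w ≡ i ⊎ lay w ≡ j) → GeneralPosition G S
  twoLayers-generalPosition S i j gap inLayers = generalPosition
    where
    InPair : ℕ → Set
    InPair ℓ = ℓ ≡ i ⊎ ℓ ≡ j

    inPair-bounds : ∀ {ℓ} → InPair ℓ → i ≤ ℓ × ℓ ≤ j
    inPair-bounds (inj₁ refl) = ≤-refl , <⇒≤ (<-trans (n<1+n i) gap)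
    inPair-bounds (inj₂ refl) = <⇒≤ (<-trans (n<1+n i) gap) , ≤-refl

    ascending-inPair : ∀ xs → Linked _≺_ xs → All (InPair ∘ lay) xs → length xs ≤ 2
    ascending-inPair []          _ _ = z≤n
    ascending-inPair (_ ∷ [])     _ _ = s≤s z≤n
    ascending-inPair (_ ∷ _ ∷ []) _ _ = s≤s (s≤s z≤n)
    ascending-inPair (_ ∷ _ ∷ _ ∷ _) (x<y ∷ y<z ∷ _) (ix ∷ inj₁ y≡i ∷ iz ∷ _) =
      contradiction (proj₁ (inPair-bounds ix)) (<⇒≱ (subst (_ <_) y≡i x<y))
    ascending-inPair (_ ∷ _ ∷ _ ∷ _) (x<y ∷ y<z ∷ _) (ix ∷ inj₂ y≡j ∷ iz ∷ _) =
      contradiction (proj₂ (inPair-bounds iz)) (<⇒≱ (subst (_< _) y≡j y<z))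

    ascending-count : Linked _≺_ p → count S p ≤ 2
    ascending-count {p} asc =
      ascending-inPair _ (Linked.filter⁺ (T? ∘ S) <-trans asc)
        (All.map (λ {w} t → inLayers w (Equivalence.to T-≡ t)) (all-filter (T? ∘ S) p))

    inPair-nonconsecutive : ∀ {x y} → Consecutive x y → InPair x → InPair y → ⊥
    inPair-nonconsecutive c (inj₁ refl) (inj₁ refl) = consecutive-irrefl c
    inPair-nonconsecutive c (inj₂ refl) (inj₂ refl) = consecutive-irrefl c
    inPair-nonconsecutive c (inj₁ refl) (inj₂ refl) = <⇒≱ gap (consecutive-≤ c)
    inPair-nonconsecutive c (inj₂ refl) (inj₁ refl) = <⇒≱ gap (consecutive-≤ (swap c))

    independent : adj G u w ≡ true → S u ≡ true → S w ≡ false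
    independent {u} {w} e Su = ¬-not λ Sw →
      inPair-nonconsecutive (step-consecutive e) (inLayers u Su) (inLayers w Sw)

    short-count : Walk G u v p → length p ≤ 3 → count S p ≤ 2
    short-count {p = p} here _                    = m≤n⇒m≤1+n (count≤length S p)
    short-count {p = p} (step _ here) _           = count≤length S p
    short-count (step e (step _ here)) _          = count-triple S _ _ _ (independent e)
    short-count (step _ (step _ (step _ wk))) (s≤s (s≤s (s≤s len))) =
      contradiction (≤-trans (walk-nonempty wk) len) λ ()

    generalPosition : GeneralPosition G S
    generalPosition u v p sp with <-cmp (lay u) (lay v)
    ... | tri< u<v _ _ = ascending-count (shortest-ascending sp u<v)
    ... | tri≈ _ same _ = let q , wq , len = sameLayer-walk same in
                          short-count (proj₁ sp) (subst (length p ≤_) len (proj₂ sp q wq))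
    ... | tri> _ _ v<u = subst (_≤ 2) (count-reverse S p)
                           (ascending-count (shortest-ascending (shortestPath-reverse sp) v<u))

  separated-mutualVisibility : (S : Fin n → Bool) →
    (∀ u v → S u ≡ true → S v ≡ true → lay u ≡ lay v → u ≡ v) →
    (∀ u v → S u ≡ true → S v ≡ true → Populated (λ w → S w ≡ false) (lay u) (lay v)) →
    MutualVisibility G S
  separated-mutualVisibility S layerwise-unique gaps u v Su Sv with <-cmp (lay u) (lay v)
  ... | tri< u<v _ _ = unobstructedPath S u<v (gaps u v Su Sv)
  ... | tri≈ _ same _ with refl ← layerwise-unique u v Su Sv same =
    [ u ] , (here , λ q wq → walk-nonempty wq) , (λ _ → inj₁ refl) ∷ []
  ... | tri> _ _ v<u with p , sp , vis ← unobstructedPath S v<u (gaps v u Sv Su) =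
    reverse p , shortestPath-reverse sp , All-resp-↭ (↭-sym (↭-reverse p)) (All.map (swap ∘_) vis)

  spine-ascending : ∀ {x y} → x Fin.< y → lay (spine x) < lay (spine y)
  spine-ascending {x} {y} x<y = subst₂ _<_ (sym (lay-spine x)) (sym (lay-spine y)) x<y

  spine-distinct : ∀ {x y} → x Fin.< y → spine x ≢ spine y
  spine-distinct x<y = <⇒≢ (spine-ascending x<y) ∘ cong lay

  generalPosition-spineTriple-free : (S : Fin n → Bool) → GeneralPosition G S → ∀ {x y z} →
    x Fin.< y → y Fin.< z → S (spine x) ≡ true → S (spine y) ≡ true → S (spine z) ≡ true → ⊥
  generalPosition-spineTriple-free S generalPosition {x} {y} {z} x<y y<z Sx Sy Sz
    with p , sp@(wk , _) , onSpine ←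
           ascendingPath OnSpine (spine-ascending (<-trans x<y y<z)) (x , refl) (z , refl) (spine-populated _)
    = contradiction (generalPosition _ _ p sp) (<⇒≱ (begin-strict
        2         <⟨ ≤-refl ⟩
        3         ≤⟨ three-members⇒length≥3 (selected x ≤-refl (<⇒≤ x<z) Sx)
                                            (selected y (<⇒≤ x<y) (<⇒≤ y<z) Sy)
                                            (selected z (<⇒≤ x<z) ≤-refl Sz)
                                            (spine-distinct x<y) (spine-distinct x<z) (spine-distinct y<z) ⟩
        count S p ∎))
    where
    open ≤-Reasoning
    x<z : x Fin.< z
    x<z = <-trans x<y y<z
    selected : ∀ m → toℕ x ≤ toℕ m → toℕ m ≤ toℕ z → S (spine m) ≡ true → spine m ∈ filter (T? ∘ S) p
    selected m x≤m m≤z Sm = ∈-filter⁺ (T? ∘ S)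
      (all-any-combine onSpine
        (walk-crosses wk (subst (_≤ toℕ m) (sym (lay-spine x)) x≤m) (subst (toℕ m ≤_) (sym (lay-spine z)) m≤z))
        (λ { (ℓ , refl) lw → cong spine (sym (toℕ-injective (trans (sym (lay-spine ℓ)) lw))) }))
      (Equivalence.from T-≡ Sm)

  generalPosition-colours-lower : PColouring (GeneralPosition G) k → L ≤ k + k
  generalPosition-colours-lower (c , generalPosition) = ≮⇒≥ λ k+k<L →
    let x , y , z , x<y , y<z , cx≡cy , cy≡cz = monochromaticTriple (c ∘ spine) k+k<L
    in generalPosition-spineTriple-free (ColourClass c (c (spine y))) (generalPosition _) x<y y<z
         (⇒colourClass c _ cx≡cy) (⇒colourClass c _ refl) (⇒colourClass c _ (sym cy≡cz))

Realisable : ℕ → ℕ → Set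
Realisable a b = ∃[ n ] Σ (Graph n) (λ G → Connected G × IsChiMu G a × IsChiGp G b)

module Construction (a′ d : ℕ) where

  a t b L order : ℕ
  a = suc (suc a′)
  t = d + d
  b = a + d
  L = (a + t) + a
  order = L + t

  L≡b+b : L ≡ b + b
  L≡b+b = lemma a d
    where
    lemma : ∀ a d → (a + (d + d)) + a ≡ (a + d) + (a + d)
    lemma = solve-∀

  -- The spine vertex ℓ ↑ˡ t lies on layer ℓ < L and the twin L ↑ʳ k on layer a + k, so the t layers
  -- a, …, a + t - 1 hold two vertices each and the other 2a layers are thin.
  lay : Fin order → ℕ
  lay = [ toℕ , (λ k → a + toℕ k) ]′ ∘ splitAt L

  spine : Fin L → Fin order
  spine ℓ = ℓ ↑ˡ t

  twin : Fin t → Fin order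
  twin k = L ↑ʳ k

  lay-spine : ∀ ℓ → lay (spine ℓ) ≡ toℕ ℓ
  lay-spine ℓ rewrite splitAt-↑ˡ L ℓ t = refl

  lay-twin : ∀ k → lay (twin k) ≡ a + toℕ k
  lay-twin k rewrite splitAt-↑ʳ L t k = refl

  Thick : ℕ → Set
  Thick ℓ = a ≤ ℓ × ℓ < a + t

  twin-thick : ∀ k → Thick (lay (twin k))
  twin-thick k rewrite lay-twin k = m≤m+n a (toℕ k) , +-monoʳ-< a (toℕ<n k)

  lay<L : ∀ w → lay w < L
  lay<L w with splitAtView L w
  ... | left ℓ  = subst (_< L) (sym (lay-spine ℓ)) (toℕ<n ℓ)
  ... | right k = <-≤-trans (proj₂ (twin-thick k)) (m≤m+n (a + t) a)

  2≤L : 2 ≤ L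
  2≤L = ≤-trans (s≤s (s≤s z≤n)) (m≤n+m a (a + t))

  open Layered lay
  open LayeredWithSpine lay spine lay-spine lay<L 2≤L

  gpColour : Fin order → Fin b
  gpColour w = fromℕ< (m%n<n (lay w) b)

  gpColour-class : ∀ i w → ColourClass gpColour i w ≡ true → lay w ≡ toℕ i ⊎ lay w ≡ toℕ i + b
  gpColour-class i w inClass = subst (λ r → lay w ≡ r ⊎ lay w ≡ r + b)
    (trans (sym (toℕ-fromℕ< _)) (cong toℕ (colourClass⇒ gpColour w inClass)))
    (%-values b (subst (lay w <_) L≡b+b (lay<L w)))

  generalPosition-chromatic : IsChiGp G b
  generalPosition-chromatic =
    (gpColour , λ i → twoLayers-generalPosition (ColourClass gpColour i) (toℕ i) (toℕ i + b)
                        (subst (_≤ toℕ i + b) (+-comm (toℕ i) 2) (+-monoʳ-≤ (toℕ i) (s≤s (s≤s z≤n))))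
                        (gpColour-class i)) ,
    λ k colouring → double-cancel-≤ (subst (_≤ k + k) L≡b+b (generalPosition-colours-lower colouring))

  data Region : Fin L → Set where
    low  : (i : Fin a) → Region ((i ↑ˡ t) ↑ˡ a)
    mid  : (k : Fin t) → Region ((a ↑ʳ k) ↑ˡ a)
    high : (i : Fin a) → Region ((a + t) ↑ʳ i)

  region : ∀ ℓ → Region ℓ
  region ℓ with splitAtView (a + t) ℓ
  ... | right i = high i
  ... | left m with splitAtView a m
  ...   | left i  = low i
  ...   | right k = mid k

  toℕ-low : ∀ (i : Fin a) → toℕ ((i ↑ˡ t) ↑ˡ a) ≡ toℕ i
  toℕ-low i = trans (toℕ-↑ˡ (i ↑ˡ t) a) (toℕ-↑ˡ i t)

  toℕ-mid : ∀ (k : Fin t) → toℕ ((a ↑ʳ k) ↑ˡ a) ≡ a + toℕ k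
  toℕ-mid k = trans (toℕ-↑ˡ (a ↑ʳ k) a) (toℕ-↑ʳ a k)

  toℕ-high : ∀ i → toℕ ((a + t) ↑ʳ i) ≡ (a + t) + toℕ i
  toℕ-high i = toℕ-↑ʳ {m = a} (a + t) i

  -- Thin layers i and a + t + i get colour i; on a thick layer the spine vertex gets 0 and the twin 1.
  mvColour : Fin order → Fin a
  mvColour = [ [ [ id , (λ _ → fzero) ]′ ∘ splitAt a , id ]′ ∘ splitAt (a + t)
             , (λ _ → fsuc fzero) ]′ ∘ splitAt L

  colour-low : ∀ i → mvColour (spine ((i ↑ˡ t) ↑ˡ a)) ≡ i
  colour-low i rewrite splitAt-↑ˡ L ((i ↑ˡ t) ↑ˡ a) t | splitAt-↑ˡ (a + t) (i ↑ˡ t) a | splitAt-↑ˡ a i t = refl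

  colour-mid : ∀ k → mvColour (spine ((a ↑ʳ k) ↑ˡ a)) ≡ fzero
  colour-mid k rewrite splitAt-↑ˡ L ((a ↑ʳ k) ↑ˡ a) t | splitAt-↑ˡ (a + t) (a ↑ʳ k) a | splitAt-↑ʳ a t k = refl

  colour-high : ∀ i → mvColour (spine ((a + t) ↑ʳ i)) ≡ i
  colour-high i rewrite splitAt-↑ˡ L ((a + t) ↑ʳ i) t | splitAt-↑ʳ (a + t) a i = refl

  colour-twin : ∀ k → mvColour (twin k) ≡ fsuc fzero
  colour-twin k rewrite splitAt-↑ʳ L t k = refl

  colour-thick : ∀ ℓ → Thick (toℕ ℓ) → mvColour (spine ℓ) ≡ fzero
  colour-thick ℓ (a≤ℓ , ℓ<a+t) with region ℓ
  ... | low i  = contradiction (toℕ<n i) (≤⇒≯ (subst (a ≤_) (toℕ-low i) a≤ℓ))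
  ... | mid k  = colour-mid k
  ... | high i = contradiction (subst (_< a + t) (toℕ-high i) ℓ<a+t) (≤⇒≯ (m≤m+n (a + t) (toℕ i)))

  mvColour-range : ∀ w {j} → mvColour w ≡ j → toℕ j ≤ lay w × lay w ≤ toℕ j + (a + t)
  mvColour-range w refl with splitAtView L w
  ... | right k rewrite colour-twin k | lay-twin k =
    ≤-trans (s≤s z≤n) (m≤m+n a (toℕ k)) , ≤-trans (<⇒≤ (+-monoʳ-< a (toℕ<n k))) (n≤1+n _)
  ... | left ℓ rewrite lay-spine ℓ with region ℓ
  ...   | low i  rewrite colour-low i  | toℕ-low i  = ≤-refl , m≤m+n (toℕ i) (a + t)
  ...   | mid k  rewrite colour-mid k  | toℕ-mid k  = z≤n , <⇒≤ (+-monoʳ-< a (toℕ<n k))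
  ...   | high i rewrite colour-high i | toℕ-high i =
    m≤n+m (toℕ i) (a + t) , ≤-reflexive (+-comm (a + t) (toℕ i))

  recoloured : ∀ j ℓ → toℕ j < toℕ ℓ → toℕ ℓ < toℕ j + (a + t) → ∃[ w ] lay w ≡ toℕ ℓ × mvColour w ≢ j
  recoloured j ℓ j<ℓ ℓ<j+a+t with region ℓ
  ... | low i = spine ((i ↑ˡ t) ↑ˡ a) , lay-spine _ , λ i≡j →
    <-irrefl (cong toℕ (trans (sym i≡j) (colour-low i))) (subst (toℕ j <_) (toℕ-low i) j<ℓ)
  ... | high i = spine ((a + t) ↑ʳ i) , lay-spine _ , λ i≡j →
    <-irrefl (cong toℕ (trans (sym (colour-high i)) i≡j))
      (+-cancelʳ-< (a + t) (toℕ i) (toℕ j)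
        (subst (_< toℕ j + (a + t)) (trans (toℕ-high i) (+-comm (a + t) (toℕ i))) ℓ<j+a+t))
  ... | mid k with j
  ...   | fzero  = twin k , trans (lay-twin k) (sym (toℕ-mid k)) ,
                   λ c → case trans (sym (colour-twin k)) c of λ ()
  ...   | fsuc _ = spine ((a ↑ʳ k) ↑ˡ a) , lay-spine _ ,
                   λ c → case trans (sym (colour-mid k)) c of λ ()

  mvColour-gaps : ∀ j u v → mvColour u ≡ j → mvColour v ≡ j → Populated (λ w → mvColour w ≢ j) (lay u) (lay v)
  mvColour-gaps j u v cu cv ℓ u<ℓ ℓ<v
    with fromℕ< (<-trans ℓ<v (lay<L v)) | toℕ-fromℕ< (<-trans ℓ<v (lay<L v))
  ... | position | refl = recoloured j position (≤-<-trans (proj₁ (mvColour-range u cu)) u<ℓ)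
                                                (<-≤-trans ℓ<v (proj₂ (mvColour-range v cv)))

  spine-twin-colours : ∀ ℓ k → lay (twin k) ≡ lay (spine ℓ) → mvColour (spine ℓ) ≢ mvColour (twin k)
  spine-twin-colours ℓ k same c =
    case trans (sym (colour-thick ℓ (subst Thick (trans same (lay-spine ℓ)) (twin-thick k))))
               (trans c (colour-twin k)) of λ ()

  mvColour-layerwise-unique : ∀ u v → mvColour u ≡ mvColour v → lay u ≡ lay v → u ≡ v
  mvColour-layerwise-unique u v c same with splitAtView L u | splitAtView L v
  ... | left ℓ  | left ℓ′  =
    cong spine (toℕ-injective (trans (sym (lay-spine ℓ)) (trans same (lay-spine ℓ′))))
  ... | right k | right k′ =
    cong twin (toℕ-injective (+-cancelˡ-≡ a _ _ (trans (sym (lay-twin k)) (trans same (lay-twin k′)))))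
  ... | left ℓ  | right k  = contradiction c (spine-twin-colours ℓ k (sym same))
  ... | right k | left ℓ   = contradiction (sym c) (spine-twin-colours ℓ k same)

  mvColouring : PColouring (MutualVisibility G) a
  mvColouring = mvColour , λ j →
    let inClass = colourClass⇒ mvColour in
    separated-mutualVisibility (ColourClass mvColour j)
      (λ u v Su Sv → mvColour-layerwise-unique u v (trans (inClass u Su) (sym (inClass v Sv))))
      (λ u v Su Sv → populated-map (λ {w} ¬j → ¬-not (¬j ∘ inClass w))
                                   (mvColour-gaps j u v (inClass u Su) (inClass v Sv)))

  thin : Fin (a + a) → Fin L
  thin = [ (λ i → (i ↑ˡ t) ↑ˡ a) , (a + t) ↑ʳ_ ]′ ∘ splitAt a

  toℕ-thin-low : ∀ i → toℕ (thin (i ↑ˡ a)) ≡ toℕ i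
  toℕ-thin-low i rewrite splitAt-↑ˡ a i a = toℕ-low i

  toℕ-thin-high : ∀ i → toℕ (thin (a ↑ʳ i)) ≡ (a + t) + toℕ i
  toℕ-thin-high i rewrite splitAt-↑ʳ a a i = toℕ-high i

  thin-increasing : ∀ {x y} → x Fin.< y → toℕ (thin x) < toℕ (thin y)
  thin-increasing {x} {y} x<y with splitAtView a x | splitAtView a y
  ... | left i  | left i′  = subst₂ _<_ (sym (toℕ-thin-low i)) (sym (toℕ-thin-low i′))
                               (subst₂ _<_ (toℕ-↑ˡ i a) (toℕ-↑ˡ i′ a) x<y)
  ... | left i  | right i′ = subst₂ _<_ (sym (toℕ-thin-low i)) (sym (toℕ-thin-high i′))
                               (<-≤-trans (toℕ<n i) (≤-trans (m≤m+n a t) (m≤m+n (a + t) (toℕ i′))))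
  ... | right i | left i′  = contradiction (<-trans (subst₂ _<_ (toℕ-↑ʳ a i) (toℕ-↑ˡ i′ a) x<y) (toℕ<n i′))
                                           (≤⇒≯ (m≤m+n a (toℕ i)))
  ... | right i | right i′ = subst₂ _<_ (sym (toℕ-thin-high i)) (sym (toℕ-thin-high i′))
                               (+-monoʳ-< (a + t) (+-cancelˡ-< a _ _ (subst₂ _<_ (toℕ-↑ʳ a i) (toℕ-↑ʳ a i′) x<y)))

  thin-not-thick : ∀ x → ¬ Thick (toℕ (thin x))
  thin-not-thick x (a≤ , <a+t) with splitAtView a x
  ... | left i  = <⇒≱ (toℕ<n i) (subst (a ≤_) (toℕ-thin-low i) a≤)
  ... | right i = <⇒≱ (subst (_< a + t) (toℕ-thin-high i) <a+t) (m≤m+n (a + t) (toℕ i))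

  thin-isolated : ∀ x w → lay w ≡ lay (spine (thin x)) → w ≡ spine (thin x)
  thin-isolated x w same with splitAtView L w
  ... | left ℓ  = cong spine (toℕ-injective (trans (sym (lay-spine ℓ)) (trans same (lay-spine (thin x)))))
  ... | right k = contradiction (subst Thick (trans same (lay-spine (thin x))) (twin-thick k)) (thin-not-thick x)

  mutualVisibility-chromatic : IsChiMu G a
  mutualVisibility-chromatic = mvColouring , λ k colouring → double-cancel-≤
    (mutualVisibility-colours-lower (spine ∘ thin) (spine-ascending ∘ thin-increasing) thin-isolated colouring)

  realises : Realisable a b
  realises = order , G , connected , mutualVisibility-chromatic , generalPosition-chromatic

colouring-of-inhabited : Fin n → (Fin n → Fin k) → 1 ≤ k
colouring-of-inhabited w c = ≤-<-trans z≤n (toℕ<n (c w))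

visibleColouring⇒generalPositionColouring : PColouring (MutualVisibility H) 1 → PColouring (GeneralPosition H) 1
visibleColouring⇒generalPositionColouring (c , visible) =
  c , λ _ → visibleEverywhere⇒generalPosition _ (visible fzero) (λ w → ⇒colourClass c w (only (c w))) _
  where
  only : (i : Fin 1) → i ≡ fzero
  only fzero = refl

chiMu≡1⇒chiGp≤1 : ∀ {b} → IsChiMu H 1 → IsChiGp H b → b ≤ 1
chiMu≡1⇒chiGp≤1 (visible , _) (_ , minimal) = minimal 1 (visibleColouring⇒generalPositionColouring visible)

K₁ : Graph 1
K₁ = record { adj = λ _ _ → false ; sym = λ _ _ → refl ; irrefl = λ _ → refl }

K₁-realises : Realisable 1 1
K₁-realises = 1 , K₁ , (λ { fzero fzero → _ , here }) ,
              (visibleColouring , λ _ → colouring-of-inhabited fzero ∘ proj₁) ,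
              (visibleColouring⇒generalPositionColouring visibleColouring ,
               λ _ → colouring-of-inhabited fzero ∘ proj₁)
  where
  visibleColouring : PColouring (MutualVisibility K₁) 1
  visibleColouring = (λ _ → fzero) , λ { _ fzero fzero _ _ →
    _ , (here , λ _ → walk-nonempty) , (λ _ → inj₁ refl) ∷ [] }

mainTheorem9 : (a b : ℕ) → 1 ≤ a → a ≤ b →
    (∃[ n ] Σ (Graph n) (λ G → Connected G × IsChiMu G a × IsChiGp G b))
    ⇔ ((a ≡ 1 × b ≡ 1) ⊎ (2 ≤ a × a ≤ b))
mainTheorem9 (suc zero) b _ 1≤b = mk⇔
  (λ (_ , _ , _ , χμ≡1 , χgp≡b) → inj₁ (refl , ≤-antisym (chiMu≡1⇒chiGp≤1 χμ≡1 χgp≡b) 1≤b))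
  (λ { (inj₁ (_ , refl)) → K₁-realises ; (inj₂ (s≤s () , _)) })
mainTheorem9 (suc (suc a′)) b _ a≤b = mk⇔ (λ _ → inj₂ (s≤s (s≤s z≤n) , a≤b)) (λ _ → construction)
  where
  construction : Realisable (suc (suc a′)) b
  construction with d , refl ← m≤n⇒∃[o]m+o≡n a≤b = Construction.realises a′ d
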